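{- Let $k = 2k'+1$ be an odd positive integer and $m = 2m'$ an even positive integer with $m > 10k^2$. Let $V = (\mathbb{F}_2^m)^m$ and let $B = \{e_{i,j}\}_{i,j \in [m]}$ be its standard basis, where $e_{i,j}$ is the vector whose $j$-th component (in the $j$-th copy of $\mathbb{F}_2^m$) is the $i$-th standard basis vector of $\mathbb{F}_2^m$ and whose other components are zero. For $0 \le d \le m$ let $L_d = \{x \in \mathbb{F}_2^m : |x| = d\}$, where $|x|$ is the number of nonzero coordinates, and let $\Sigma = L_{m'-k'} \cup \dots \cup L_{m'+k'}$. Let $A = \Sigma^m \subset V$ be the direct product of $m$ copies of $\Sigma$. Then \[ \mathbb{P}(a + b \in A \mid a \in A, b \in B) \geq 1 - \frac{2}{k},\] where $a, b$ are chosen independently and uniformly from $A, B$; that is, $|\{(a,b) \in A \times B : a + b \in A\}| \geq (1 - \frac{2}{k})|A||B|$. -}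

module Defs where

open import Data.Nat using (ℕ; zero; suc; _+_; _*_; _∸_; _≤ᵇ_)
open import Data.Bool using (Bool; true; false; if_then_else_; _∧_; _xor_)
open import Data.Fin using (Fin; zero; suc)
open import Data.Fin.Properties using () renaming (_≟_ to _≟ᶠ_)
open import Relation.Nullary.Decidable using (⌊_⌋)
open import Data.Vec.Functional using (_∷_)

F2^ : ℕ → Set
F2^ n = Fin n → Bool

-- V = (F₂^m)^m : a j i is the i-th coordinate of the j-th copy.
V : ℕ → Set
V m = Fin m → F2^ m

sumFin : (n : ℕ) → (Fin n → ℕ) → ℕ
sumFin zero    f = 0
sumFin (suc n) f = f zero + sumFin n (λ i → f (suc i))

sumΠ : {X : Set} (n : ℕ) → ((X → ℕ) → ℕ) → ((Fin n → X) → ℕ) → ℕ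
sumΠ zero    sX f = f (λ ())
sumΠ (suc n) sX f = sX (λ x → sumΠ n sX (λ g → f (x ∷ g)))

sumBool : (Bool → ℕ) → ℕ
sumBool f = f false + f true

sumF2^ : (n : ℕ) → (F2^ n → ℕ) → ℕ
sumF2^ n = sumΠ n sumBool

sumV : (m : ℕ) → (V m → ℕ) → ℕ
sumV m = sumΠ m (sumF2^ m)

weight : {n : ℕ} → F2^ n → ℕ
weight {n} x = sumFin n (λ i → if x i then 1 else 0)

inΣ : (m' k' : ℕ) → F2^ (2 * m') → Bool
inΣ m' k' x = ((m' ∸ k') ≤ᵇ weight x) ∧ (weight x ≤ᵇ (m' + k'))

allFin : (n : ℕ) → (Fin n → Bool) → Bool
allFin zero    p = true
allFin (suc n) p = p zero ∧ allFin n (λ i → p (suc i))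

inA : (m' k' : ℕ) → V (2 * m') → Bool
inA m' k' a = allFin (2 * m') (λ j → inΣ m' k' (a j))

𝟙 : Bool → ℕ
𝟙 b = if b then 1 else 0

e : {m : ℕ} → Fin m → Fin m → V m
e i j j' i' = ⌊ j' ≟ᶠ j ⌋ ∧ ⌊ i' ≟ᶠ i ⌋

_⊕_ : {m : ℕ} → V m → V m → V m
(a ⊕ b) j i = a j i xor b j i

cardA : (m' k' : ℕ) → ℕ
cardA m' k' = sumV (2 * m') (λ a → 𝟙 (inA m' k' a))

-- |{(a,b) ∈ A × B : a + b ∈ A}|, B = {e_{i,j}} (m² distinct elements)
goodPairs : (m' k' : ℕ) → ℕ
goodPairs m' k' =
  sumV (2 * m') (λ a →
    sumFin (2 * m') (λ i → sumFin (2 * m') (λ j →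
      𝟙 (inA m' k' a ∧ inA m' k' (a ⊕ e i j)))))

-- An element of A is a vector of m blocks in Σ, and adding e_{i,j} flips coordinate i of block j only.
-- So the good pairs factorise: |Σ| · #good = m · |Σ|^m · E, where E counts the pairs (x, i) with
-- x ∈ Σ and x + e_i ∈ Σ. Counting by weight, a vertex of weight d in the window [a, b] =
-- [m' - k', m' + k'] has all its m neighbours in Σ unless d = a or d = b, so
-- m |Σ| ≤ E + m (C(m, a) + C(m, b)). Binomial coefficients are symmetric and increase up to the
-- middle, so each of the k levels of the window has at least C(m, a) = C(m, b) elements, that is
-- k C(m, a) ≤ |Σ|. Together k m |Σ| ≤ k E + 2 m |Σ|. The hypothesis m > 10k² is only needed for
-- k' ≤ m'.

module Submission where

open import Defs
open import Data.Nat using (ℕ; zero; suc; pred; _+_; _*_; _∸_; _^_; _≤_; _<_; _≡ᵇ_; _≤ᵇ_; z≤n; s≤s; z<s)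
open import Data.Nat.Properties
open import Data.Nat.Combinatorics using (_C_; nCk+nC[k+1]≡[n+1]C[k+1]; nC1≡n; k>n⇒nCk≡0; nCk≡nC[n∸k])
open import Data.Nat.Tactic.RingSolver using (solve-∀)
open import Data.Bool using (Bool; true; false; not; _∧_; _xor_; if_then_else_; T)
open import Data.Bool.Properties using (xor-identityʳ; xor-comm; true-xor; ∧-zeroʳ; ∧-idem)
open import Data.Fin using (Fin; zero; suc)
open import Data.Fin.Properties using () renaming (_≟_ to _≟ᶠ_)
open import Data.Product using (_×_; _,_; proj₁; proj₂)
open import Data.Sum using (inj₁; inj₂)
open import Data.Vec.Functional using (_∷_)
open import Relation.Nullary.Decidable using (⌊_⌋; yes; no)
open import Relation.Binary.PropositionalEquality
open import Function using (_∘_)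
import Algebra.Properties.CommutativeSemigroup as CommSemigroupProperties

open CommSemigroupProperties +-commutativeSemigroup using ()
  renaming (interchange to +-interchange; xy∙z≈zy∙x to +-swap-outer; x∙yz≈y∙xz to +-swap-inner)
open CommSemigroupProperties *-commutativeSemigroup using () renaming (x∙yz≈y∙xz to *-swap-inner)

-- Linear summation operators

record IsLinearSum {X : Set} (s : (X → ℕ) → ℕ) : Set where
  field
    sum-cong       : ∀ {f g : X → ℕ} → (∀ x → f x ≡ g x) → s f ≡ s g
    sum-distrib-+  : ∀ (f g : X → ℕ) → s (λ x → f x + g x) ≡ s f + s g
    sum-distribˡ-* : ∀ c (f : X → ℕ) → s (λ x → c * f x) ≡ c * s f

  sum-zero : s (λ _ → 0) ≡ 0
  sum-zero = sum-distribˡ-* 0 (λ _ → 0)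

  sum-mono : ∀ {f g : X → ℕ} → (∀ x → f x ≤ g x) → s f ≤ s g
  sum-mono {f} {g} f≤g = begin
    s f                          ≤⟨ m≤m+n (s f) _ ⟩
    s f + s (λ x → g x ∸ f x)    ≡⟨ sum-distrib-+ f _ ⟨
    s (λ x → f x + (g x ∸ f x))  ≡⟨ sum-cong (λ x → m+[n∸m]≡n (f≤g x)) ⟩
    s g                          ∎
    where open ≤-Reasoning

  sum-sumFin-comm : ∀ N (φ : Fin N → X → ℕ) →
                    s (λ x → sumFin N (λ i → φ i x)) ≡ sumFin N (λ i → s (φ i))
  sum-sumFin-comm zero    φ = sum-zero
  sum-sumFin-comm (suc N) φ =
    trans (sum-distrib-+ _ _) (cong (s (φ zero) +_) (sum-sumFin-comm N (λ i → φ (suc i))))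

open IsLinearSum

sumBool-isLinear : IsLinearSum sumBool
sumBool-isLinear = record
  { sum-cong       = λ f≗g → cong₂ _+_ (f≗g false) (f≗g true)
  ; sum-distrib-+  = λ f g → +-interchange (f false) (g false) (f true) (g true)
  ; sum-distribˡ-* = λ c f → sym (*-distribˡ-+ c (f false) (f true))
  }

sumFin-isLinear : ∀ n → IsLinearSum (sumFin n)
sumFin-isLinear n = record { sum-cong = cng n ; sum-distrib-+ = dst n ; sum-distribˡ-* = scl n }
  where
  cng : ∀ n {f g : Fin n → ℕ} → (∀ i → f i ≡ g i) → sumFin n f ≡ sumFin n g
  cng zero    f≗g = refl
  cng (suc n) f≗g = cong₂ _+_ (f≗g zero) (cng n (λ i → f≗g (suc i)))
  dst : ∀ n (f g : Fin n → ℕ) → sumFin n (λ i → f i + g i) ≡ sumFin n f + sumFin n g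
  dst zero    f g = refl
  dst (suc n) f g = trans (cong (f zero + g zero +_) (dst n _ _)) (+-interchange (f zero) (g zero) _ _)
  scl : ∀ n c (f : Fin n → ℕ) → sumFin n (λ i → c * f i) ≡ c * sumFin n f
  scl zero    c f = sym (*-zeroʳ c)
  scl (suc n) c f = trans (cong (c * f zero +_) (scl n c _)) (sym (*-distribˡ-+ c _ _))

sumFin-const : ∀ n c → sumFin n (λ _ → c) ≡ n * c
sumFin-const zero    c = refl
sumFin-const (suc n) c = cong (c +_) (sumFin-const n c)

sumΠ-isLinear : ∀ {X : Set} {s : (X → ℕ) → ℕ} → IsLinearSum s → ∀ n → IsLinearSum (sumΠ n s)
sumΠ-isLinear {s = s} L n = record { sum-cong = cng n ; sum-distrib-+ = dst n ; sum-distribˡ-* = scl n }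
  where
  cng : ∀ n {f g} → (∀ x → f x ≡ g x) → sumΠ n s f ≡ sumΠ n s g
  cng zero    f≗g = f≗g _
  cng (suc n) f≗g = sum-cong L (λ x → cng n (λ g → f≗g (x ∷ g)))
  dst : ∀ n f g → sumΠ n s (λ x → f x + g x) ≡ sumΠ n s f + sumΠ n s g
  dst zero    f g = refl
  dst (suc n) f g = trans (sum-cong L (λ x → dst n _ _)) (sum-distrib-+ L _ _)
  scl : ∀ n c f → sumΠ n s (λ x → c * f x) ≡ c * sumΠ n s f
  scl zero    c f = refl
  scl (suc n) c f = trans (sum-cong L (λ x → scl n c _)) (sum-distribˡ-* L c _)

sumF2^-isLinear : ∀ n → IsLinearSum (sumF2^ n)
sumF2^-isLinear = sumΠ-isLinear sumBool-isLinear

sumV-isLinear : ∀ m → IsLinearSum (sumV m)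
sumV-isLinear m = sumΠ-isLinear (sumF2^-isLinear m) m

prodFin : (n : ℕ) → (Fin n → ℕ) → ℕ
prodFin zero    h = 1
prodFin (suc n) h = h zero * prodFin n (λ i → h (suc i))

prodFin-cong : ∀ n {f g : Fin n → ℕ} → (∀ i → f i ≡ g i) → prodFin n f ≡ prodFin n g
prodFin-cong zero    f≗g = refl
prodFin-cong (suc n) f≗g = cong₂ _*_ (f≗g zero) (prodFin-cong n (λ i → f≗g (suc i)))

prodFin-const : ∀ n c → prodFin n (λ _ → c) ≡ c ^ n
prodFin-const zero    c = refl
prodFin-const (suc n) c = cong (c *_) (prodFin-const n c)

⌊suc≟suc⌋ : ∀ {n} (i j : Fin n) → ⌊ Fin.suc i ≟ᶠ suc j ⌋ ≡ ⌊ i ≟ᶠ j ⌋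
⌊suc≟suc⌋ i j with i ≟ᶠ j
... | yes _ = refl
... | no  _ = refl

prodFin-single : ∀ n (j : Fin n) c s → s * prodFin n (λ j′ → if ⌊ j′ ≟ᶠ j ⌋ then c else s) ≡ c * s ^ n
prodFin-single (suc n) zero    c s = trans (cong (λ p → s * (c * p)) (prodFin-const n s)) (*-swap-inner s c _)
prodFin-single (suc n) (suc j) c s = begin
  s * (s * prodFin n (λ j′ → if ⌊ Fin.suc j′ ≟ᶠ suc j ⌋ then c else s))
    ≡⟨ cong (λ p → s * (s * p)) (prodFin-cong n (λ j′ → cong (if_then c else s) (⌊suc≟suc⌋ j′ j))) ⟩
  s * (s * prodFin n (λ j′ → if ⌊ j′ ≟ᶠ j ⌋ then c else s))
    ≡⟨ cong (s *_) (prodFin-single n j c s) ⟩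
  s * (c * s ^ n)
    ≡⟨ *-swap-inner s c _ ⟩
  c * (s * s ^ n) ∎
  where open ≡-Reasoning

sumΠ-prodFin : ∀ {X : Set} {s : (X → ℕ) → ℕ} → IsLinearSum s → ∀ n (h : Fin n → X → ℕ) →
               sumΠ n s (λ x → prodFin n (λ j → h j (x j))) ≡ prodFin n (λ j → s (h j))
sumΠ-prodFin L zero    h = refl
sumΠ-prodFin {s = s} L (suc n) h = begin
  s (λ x → sumΠ n s (λ g → h zero x * prodFin n (λ j → h (suc j) (g j))))
    ≡⟨ sum-cong L (λ x → sum-distribˡ-* (sumΠ-isLinear L n) (h zero x) _) ⟩
  s (λ x → h zero x * sumΠ n s (λ g → prodFin n (λ j → h (suc j) (g j))))
    ≡⟨ sum-cong L (λ x → trans (cong (h zero x *_) (sumΠ-prodFin L n (λ j → h (suc j)))) (*-comm (h zero x) _)) ⟩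
  s (λ x → rest * h zero x)
    ≡⟨ sum-distribˡ-* L rest (h zero) ⟩
  rest * s (h zero)
    ≡⟨ *-comm rest _ ⟩
  s (h zero) * rest ∎
  where
  open ≡-Reasoning
  rest : ℕ
  rest = prodFin n (λ j → s (h (suc j)))

-- Binomial coefficients

-- Absorption (k + 1) C(n, k + 1) = (n - k) C(n, k), with k C(n, k) moved across to avoid subtraction.
[1+k]*nC[1+k]+k*nCk≡n*nCk : ∀ n k → suc k * (n C suc k) + k * (n C k) ≡ n * (n C k)
[1+k]*nC[1+k]+k*nCk≡n*nCk zero    zero    = refl
[1+k]*nC[1+k]+k*nCk≡n*nCk zero    (suc k) =
  trans (cong₂ (λ u v → suc (suc k) * u + suc k * v) (k>n⇒nCk≡0 {0} {suc (suc k)} z<s) (k>n⇒nCk≡0 {0} {suc k} z<s))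
        (cong₂ _+_ (*-zeroʳ (suc (suc k))) (*-zeroʳ (suc k)))
[1+k]*nC[1+k]+k*nCk≡n*nCk (suc n) zero    = begin
  1 * (suc n C 1) + 0  ≡⟨ +-identityʳ _ ⟩
  1 * (suc n C 1)      ≡⟨ *-identityˡ _ ⟩
  suc n C 1            ≡⟨ nC1≡n (suc n) ⟩
  suc n                ≡⟨ *-identityʳ (suc n) ⟨
  suc n * 1            ∎
  where open ≡-Reasoning
[1+k]*nC[1+k]+k*nCk≡n*nCk (suc n) (suc k) = begin
  suc (suc k) * (suc n C suc (suc k)) + suc k * (suc n C suc k)
    ≡⟨ cong₂ (λ u v → suc (suc k) * u + suc k * v) (pascal n (suc k)) (pascal n k) ⟨
  suc (suc k) * (c₁ + c₂) + suc k * (c₀ + c₁)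
    ≡⟨ regroup k c₀ c₁ c₂ ⟩
  (suc (suc k) * c₂ + suc k * c₁) + (suc k * c₁ + k * c₀) + (c₀ + c₁)
    ≡⟨ cong₂ (λ u v → u + v + (c₀ + c₁)) ([1+k]*nC[1+k]+k*nCk≡n*nCk n (suc k)) ([1+k]*nC[1+k]+k*nCk≡n*nCk n k) ⟩
  n * c₁ + n * c₀ + (c₀ + c₁)
    ≡⟨ collect n c₀ c₁ ⟩
  suc n * (c₀ + c₁)
    ≡⟨ cong (suc n *_) (pascal n k) ⟩
  suc n * (suc n C suc k) ∎
  where
  open ≡-Reasoning
  pascal : ∀ n k → n C k + n C suc k ≡ suc n C suc k
  pascal = nCk+nC[k+1]≡[n+1]C[k+1]
  c₀ c₁ c₂ : ℕ
  c₀ = n C k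
  c₁ = n C suc k
  c₂ = n C suc (suc k)
  regroup : ∀ k c₀ c₁ c₂ → suc (suc k) * (c₁ + c₂) + suc k * (c₀ + c₁)
          ≡ (suc (suc k) * c₂ + suc k * c₁) + (suc k * c₁ + k * c₀) + (c₀ + c₁)
  regroup = solve-∀
  collect : ∀ n c₀ c₁ → n * c₁ + n * c₀ + (c₀ + c₁) ≡ suc n * (c₀ + c₁)
  collect = solve-∀

nCk≤nC[1+k] : ∀ {n k} → suc (k + k) ≤ n → n C k ≤ n C suc k
nCk≤nC[1+k] {n} {k} 2k<n = *-cancelˡ-≤ (suc k) (+-cancelʳ-≤ (k * (n C k)) _ _ (begin
  suc k * (n C k) + k * (n C k)        ≡⟨ *-distribʳ-+ (n C k) (suc k) k ⟨
  (suc k + k) * (n C k)                ≤⟨ *-monoˡ-≤ (n C k) 2k<n ⟩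
  n * (n C k)                          ≡⟨ [1+k]*nC[1+k]+k*nCk≡n*nCk n k ⟨
  suc k * (n C suc k) + k * (n C k)    ∎))
  where open ≤-Reasoning

nC-monoʳ-≤ : ∀ {n j k} → j ≤ k → k + k ≤ n → n C j ≤ n C k
nC-monoʳ-≤ {k = zero} z≤n _ = ≤-refl
nC-monoʳ-≤ {n} {j} {suc k} j≤1+k 2k+2≤n with m≤n⇒m<n∨m≡n j≤1+k
... | inj₂ refl        = ≤-refl
... | inj₁ (s≤s j≤k)   = ≤-trans (nC-monoʳ-≤ j≤k (≤-trans (n≤1+n _) 2k+1≤n)) (nCk≤nC[1+k] 2k+1≤n)
  where
  2k+1≤n : suc (k + k) ≤ n
  2k+1≤n = ≤-trans (s≤s (+-monoʳ-≤ k (n≤1+n k))) 2k+2≤n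

nCj≤nCk : ∀ {n j k} → j ≤ k → j + k ≤ n → n C j ≤ n C k
nCj≤nCk {n} {j} {k} j≤k j+k≤n with ≤-total (k + k) n
... | inj₁ 2k≤n = nC-monoʳ-≤ j≤k 2k≤n
... | inj₂ n≤2k = begin
  n C j        ≤⟨ nC-monoʳ-≤ (m+n≤o⇒m≤o∸n j j+k≤n) 2[n∸k]≤n ⟩
  n C (n ∸ k)  ≡⟨ nCk≡nC[n∸k] k≤n ⟨
  n C k        ∎
  where
  open ≤-Reasoning
  k≤n : k ≤ n
  k≤n = m+n≤o⇒n≤o j j+k≤n
  n∸k≤k : n ∸ k ≤ k
  n∸k≤k = ≤-trans (∸-monoˡ-≤ k n≤2k) (≤-reflexive (m+n∸n≡m k k))
  2[n∸k]≤n : (n ∸ k) + (n ∸ k) ≤ n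
  2[n∸k]≤n = ≤-trans (+-monoʳ-≤ (n ∸ k) n∸k≤k) (≤-reflexive (m∸n+n≡m k≤n))

-- Weights on the cube

flip : ∀ {n} → Fin n → F2^ n → F2^ n
flip i x i′ = x i′ xor ⌊ i′ ≟ᶠ i ⌋

weight-cong : ∀ {n} {x y : F2^ n} → (∀ i → x i ≡ y i) → weight x ≡ weight y
weight-cong {zero}  x≗y = refl
weight-cong {suc n} x≗y = cong₂ _+_ (cong 𝟙 (x≗y zero)) (weight-cong (λ i → x≗y (suc i)))

weight≤n : ∀ {n} (x : F2^ n) → weight x ≤ n
weight≤n {zero}  x = z≤n
weight≤n {suc n} x with x zero
... | true  = s≤s (weight≤n (λ i → x (suc i)))
... | false = m≤n⇒m≤1+n (weight≤n (λ i → x (suc i)))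

weight-flip : ∀ {n} (i : Fin n) (x : F2^ n) → weight (flip i x) + 𝟙 (x i) ≡ weight x + 𝟙 (not (x i))
weight-flip {suc n} zero x = begin
  𝟙 (x zero xor true) + weight (λ i → x (suc i) xor false) + 𝟙 (x zero)
    ≡⟨ cong₂ (λ b w → 𝟙 b + w + 𝟙 (x zero)) (trans (xor-comm (x zero) true) (true-xor (x zero)))
                                             (weight-cong (λ i → xor-identityʳ (x (suc i)))) ⟩
  𝟙 (not (x zero)) + weight x′ + 𝟙 (x zero)
    ≡⟨ +-swap-outer (𝟙 (not (x zero))) (weight x′) (𝟙 (x zero)) ⟩
  𝟙 (x zero) + weight x′ + 𝟙 (not (x zero)) ∎
  where
  open ≡-Reasoning
  x′ : F2^ n
  x′ i = x (suc i)
weight-flip {suc n} (suc i) x = begin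
  𝟙 (x zero xor false) + weight (λ i′ → x (suc i′) xor ⌊ suc i′ ≟ᶠ suc i ⌋) + 𝟙 (x′ i)
    ≡⟨ cong₂ (λ b w → 𝟙 b + w + 𝟙 (x′ i)) (xor-identityʳ (x zero))
                                           (weight-cong (λ i′ → cong (x′ i′ xor_) (⌊suc≟suc⌋ i′ i))) ⟩
  𝟙 (x zero) + weight (flip i x′) + 𝟙 (x′ i)
    ≡⟨ +-assoc (𝟙 (x zero)) _ _ ⟩
  𝟙 (x zero) + (weight (flip i x′) + 𝟙 (x′ i))
    ≡⟨ cong (𝟙 (x zero) +_) (weight-flip i x′) ⟩
  𝟙 (x zero) + (weight x′ + 𝟙 (not (x′ i)))
    ≡⟨ +-assoc (𝟙 (x zero)) _ _ ⟨
  𝟙 (x zero) + weight x′ + 𝟙 (not (x′ i)) ∎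
  where
  open ≡-Reasoning
  x′ : F2^ n
  x′ i = x (suc i)

weight-flip-if : ∀ {n} (i : Fin n) (x : F2^ n) →
                 weight (flip i x) ≡ (if x i then pred (weight x) else suc (weight x))
weight-flip-if i x with x i | weight-flip i x
... | true  | eq = trans (cong pred (+-comm 1 (weight (flip i x)))) (trans (cong pred eq) (cong pred (+-identityʳ (weight x))))
... | false | eq = trans (sym (+-identityʳ _)) (trans eq (+-comm _ 1))

sumFin-if : ∀ {n} (x : F2^ n) α β → sumFin n (λ i → if x i then α else β) ≡ weight x * α + (n ∸ weight x) * β
sumFin-if {zero}  x α β = refl
sumFin-if {suc n} x α β with x zero
... | true  = trans (cong (α +_) (sumFin-if x′ α β)) (sym (+-assoc α _ _))
  where
  x′ : F2^ n
  x′ i = x (suc i)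
... | false = begin
  β + sumFin n (λ i → if x′ i then α else β)  ≡⟨ cong (β +_) (sumFin-if x′ α β) ⟩
  β + (weight x′ * α + (n ∸ weight x′) * β)  ≡⟨ +-swap-inner β (weight x′ * α) _ ⟩
  weight x′ * α + (β + (n ∸ weight x′) * β)
    ≡⟨ cong (λ m → weight x′ * α + m * β) (+-∸-assoc 1 (weight≤n x′)) ⟨
  weight x′ * α + (suc n ∸ weight x′) * β    ∎
  where
  open ≡-Reasoning
  x′ : F2^ n
  x′ i = x (suc i)

sumFin-flip : ∀ {n} (h : ℕ → ℕ) (x : F2^ n) →
              sumFin n (λ i → h (weight (flip i x))) ≡ weight x * h (pred (weight x)) + (n ∸ weight x) * h (suc (weight x))
sumFin-flip {n} h x =
  trans (sum-cong (sumFin-isLinear n) (λ i → trans (cong h (weight-flip-if i x)) (push-h (x i))))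
        (sumFin-if x _ _)
  where
  push-h : ∀ b → h (if b then pred (weight x) else suc (weight x)) ≡ (if b then h (pred (weight x)) else h (suc (weight x)))
  push-h true  = refl
  push-h false = refl

sumUpTo : ℕ → (ℕ → ℕ) → ℕ
sumUpTo zero    f = 0
sumUpTo (suc N) f = f 0 + sumUpTo N (λ d → f (suc d))

sumUpTo-isLinear : ∀ N → IsLinearSum (sumUpTo N)
sumUpTo-isLinear N = record { sum-cong = cng N ; sum-distrib-+ = dst N ; sum-distribˡ-* = scl N }
  where
  cng : ∀ N {f g : ℕ → ℕ} → (∀ d → f d ≡ g d) → sumUpTo N f ≡ sumUpTo N g
  cng zero    f≗g = refl
  cng (suc N) f≗g = cong₂ _+_ (f≗g 0) (cng N (λ d → f≗g (suc d)))
  dst : ∀ N (f g : ℕ → ℕ) → sumUpTo N (λ d → f d + g d) ≡ sumUpTo N f + sumUpTo N g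
  dst zero    f g = refl
  dst (suc N) f g = trans (cong (f 0 + g 0 +_) (dst N _ _)) (+-interchange (f 0) (g 0) _ _)
  scl : ∀ N c (f : ℕ → ℕ) → sumUpTo N (λ d → c * f d) ≡ c * sumUpTo N f
  scl zero    c f = sym (*-zeroʳ c)
  scl (suc N) c f = trans (cong (c * f 0 +_) (scl N c _)) (sym (*-distribˡ-+ c _ _))

sumUpTo-last : ∀ N (f : ℕ → ℕ) → sumUpTo (suc N) f ≡ sumUpTo N f + f N
sumUpTo-last zero    f = +-comm (f 0) 0
sumUpTo-last (suc N) f = trans (cong (f 0 +_) (sumUpTo-last N _)) (sym (+-assoc (f 0) _ _))

sumUpTo-split : ∀ p q (f : ℕ → ℕ) → sumUpTo (p + q) f ≡ sumUpTo p f + sumUpTo q (λ d → f (p + d))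
sumUpTo-split zero    q f = refl
sumUpTo-split (suc p) q f = trans (cong (f 0 +_) (sumUpTo-split p q _)) (sym (+-assoc (f 0) _ _))

sumUpTo-lower : ∀ N c (f : ℕ → ℕ) → (∀ d → d < N → c ≤ f d) → N * c ≤ sumUpTo N f
sumUpTo-lower zero    c f c≤f = z≤n
sumUpTo-lower (suc N) c f c≤f = +-mono-≤ (c≤f 0 z<s) (sumUpTo-lower N c _ (λ d d<N → c≤f (suc d) (s≤s d<N)))

sumUpTo-point : ∀ N c (f : ℕ → ℕ) → c < N → sumUpTo N (λ d → 𝟙 (d ≡ᵇ c) * f d) ≡ f c
sumUpTo-point (suc N) zero    f _         =
  trans (cong₂ _+_ (+-identityʳ (f 0)) (sum-zero (sumUpTo-isLinear N))) (+-identityʳ (f 0))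
sumUpTo-point (suc N) (suc c) f (s≤s c<N) = sumUpTo-point N c (λ d → f (suc d)) c<N

sumUpTo-≥-segment : ∀ p q r (f : ℕ → ℕ) → sumUpTo q (λ d → f (p + d)) ≤ sumUpTo (p + (q + r)) f
sumUpTo-≥-segment p q r f = begin
  sumUpTo q (λ d → f (p + d))                                  ≤⟨ m≤m+n _ _ ⟩
  sumUpTo q (λ d → f (p + d)) + sumUpTo r (λ d → f (p + (q + d))) ≡⟨ sumUpTo-split q r _ ⟨
  sumUpTo (q + r) (λ d → f (p + d))                            ≤⟨ m≤n+m _ _ ⟩
  sumUpTo p f + sumUpTo (q + r) (λ d → f (p + d))              ≡⟨ sumUpTo-split p (q + r) f ⟨
  sumUpTo (p + (q + r)) f                                      ∎
  where open ≤-Reasoning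

sumF2^-weight : ∀ n (f : ℕ → ℕ) → sumF2^ n (λ x → f (weight x)) ≡ sumUpTo (suc n) (λ d → (n C d) * f d)
sumF2^-weight zero    f = sym (trans (+-identityʳ (1 * f 0)) (*-identityˡ (f 0)))
sumF2^-weight (suc n) f = begin
  sumF2^ n (λ x → f (weight x)) + sumF2^ n (λ x → f (suc (weight x)))
    ≡⟨ cong₂ _+_ (sumF2^-weight n f) (sumF2^-weight n (λ d → f (suc d))) ⟩
  (1 * f 0 + A) + B
    ≡⟨ trans (+-assoc (1 * f 0) A B) (cong (1 * f 0 +_) (+-comm A B)) ⟩
  1 * f 0 + (B + A)
    ≡⟨ cong (λ t → 1 * f 0 + (B + t)) A≡A+top ⟩
  1 * f 0 + (B + sumUpTo (suc n) (λ d → (n C suc d) * f (suc d)))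
    ≡⟨ cong (1 * f 0 +_) (sum-distrib-+ (sumUpTo-isLinear (suc n))
                                          (λ d → (n C d) * f (suc d)) (λ d → (n C suc d) * f (suc d))) ⟨
  1 * f 0 + sumUpTo (suc n) (λ d → (n C d) * f (suc d) + (n C suc d) * f (suc d))
    ≡⟨ cong (1 * f 0 +_) (sum-cong (sumUpTo-isLinear (suc n)) pascal) ⟩
  1 * f 0 + sumUpTo (suc n) (λ d → (suc n C suc d) * f (suc d)) ∎
  where
  open ≡-Reasoning
  A B : ℕ
  A = sumUpTo n (λ d → (n C suc d) * f (suc d))
  B = sumUpTo (suc n) (λ d → (n C d) * f (suc d))
  A≡A+top : A ≡ sumUpTo (suc n) (λ d → (n C suc d) * f (suc d))
  A≡A+top = begin
    A                                    ≡⟨ +-identityʳ A ⟨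
    A + 0                                ≡⟨ cong (λ c → A + c * f (suc n)) (k>n⇒nCk≡0 (n<1+n n)) ⟨
    A + (n C suc n) * f (suc n)            ≡⟨ sumUpTo-last n _ ⟨
    sumUpTo (suc n) (λ d → (n C suc d) * f (suc d)) ∎
  pascal : ∀ d → (n C d) * f (suc d) + (n C suc d) * f (suc d) ≡ (suc n C suc d) * f (suc d)
  pascal d = trans (sym (*-distribʳ-+ (f (suc d)) (n C d) _)) (cong (_* f (suc d)) (nCk+nC[k+1]≡[n+1]C[k+1] n d))

-- For a vertex x of the n-cube of weight d with p d: the number of neighbours y with p |y|.
stay : (ℕ → Bool) → ℕ → ℕ → ℕ
stay p n d = d * 𝟙 (p d ∧ p (pred d)) + (n ∸ d) * 𝟙 (p d ∧ p (suc d))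

vertices innerEdges : (ℕ → Bool) → ℕ → ℕ
vertices   p n = sumUpTo (suc n) (λ d → (n C d) * 𝟙 (p d))
innerEdges p n = sumUpTo (suc n) (λ d → (n C d) * stay p n d)

sumF2^-vertices : ∀ n (p : ℕ → Bool) → sumF2^ n (λ x → 𝟙 (p (weight x))) ≡ vertices p n
sumF2^-vertices n p = sumF2^-weight n (λ d → 𝟙 (p d))

sumFin-sumF2^-flip : ∀ n (p : ℕ → Bool) →
  sumFin n (λ i → sumF2^ n (λ x → 𝟙 (p (weight x) ∧ p (weight (flip i x))))) ≡ innerEdges p n
sumFin-sumF2^-flip n p = begin
  sumFin n (λ i → sumF2^ n (λ x → 𝟙 (p (weight x) ∧ p (weight (flip i x)))))
    ≡⟨ sum-sumFin-comm (sumF2^-isLinear n) n _ ⟨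
  sumF2^ n (λ x → sumFin n (λ i → 𝟙 (p (weight x) ∧ p (weight (flip i x)))))
    ≡⟨ sum-cong (sumF2^-isLinear n) (λ x → sumFin-flip (λ w → 𝟙 (p (weight x) ∧ p w)) x) ⟩
  sumF2^ n (λ x → stay p n (weight x))
    ≡⟨ sumF2^-weight n (stay p n) ⟩
  innerEdges p n ∎
  where open ≡-Reasoning

-- Windows of levels

k*x≤k*g+2*x⇒[k∸2]*x≤k*g : ∀ k x g → k * x ≤ k * g + 2 * x → (k ∸ 2) * x ≤ k * g
k*x≤k*g+2*x⇒[k∸2]*x≤k*g k x g kx≤kg+2x = begin
  (k ∸ 2) * x            ≡⟨ *-distribʳ-∸ x k 2 ⟩
  k * x ∸ 2 * x          ≤⟨ ∸-monoˡ-≤ (2 * x) kx≤kg+2x ⟩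
  k * g + 2 * x ∸ 2 * x  ≡⟨ m+n∸n≡m (k * g) (2 * x) ⟩
  k * g                  ∎
  where open ≤-Reasoning

*𝟙-≤ : ∀ {b n x} → (b ≡ true → n ≤ x) → n * 𝟙 b ≤ x
*𝟙-≤ {false} {n} _   = ≤-trans (≤-reflexive (*-zeroʳ n)) z≤n
*𝟙-≤ {true}  {n} n≤x = ≤-trans (≤-reflexive (*-identityʳ n)) (n≤x refl)

≡ᵇ-false⇒≢ : ∀ {m n} → (m ≡ᵇ n) ≡ false → m ≢ n
≡ᵇ-false⇒≢ {m} {n} m≡ᵇn m≡n = subst T m≡ᵇn (≡⇒≡ᵇ m n m≡n)

inWindow : ℕ → ℕ → ℕ → Bool
inWindow a b d = (a ≤ᵇ d) ∧ (d ≤ᵇ b)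

module _ {a b : ℕ} where

  inWindow⁺ : ∀ {d} → a ≤ d → d ≤ b → inWindow a b d ≡ true
  inWindow⁺ {d} a≤d d≤b with a ≤ᵇ d | ≤⇒≤ᵇ a≤d | d ≤ᵇ b | ≤⇒≤ᵇ d≤b
  ... | true | _ | true | _ = refl

  inWindow⁻ : ∀ {d} → inWindow a b d ≡ true → a ≤ d × d ≤ b
  inWindow⁻ {d} d∈W with a ≤ᵇ d in a≤ᵇd | d ≤ᵇ b in d≤ᵇb
  ... | true | true = ≤ᵇ⇒≤ a d (subst T (sym a≤ᵇd) _) , ≤ᵇ⇒≤ d b (subst T (sym d≤ᵇb) _)

  -- Inside the window, a vertex loses neighbours only across the two boundary levels a and b.
  stay-window : ∀ n d → n * 𝟙 (inWindow a b d) ≤ stay (inWindow a b) n d + (𝟙 (d ≡ᵇ a) + 𝟙 (d ≡ᵇ b)) * n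
  stay-window n d = *𝟙-≤ inside
    where
    W : ℕ → Bool
    W = inWindow a b
    inside : W d ≡ true → n ≤ stay W n d + (𝟙 (d ≡ᵇ a) + 𝟙 (d ≡ᵇ b)) * n
    inside d∈W with d ≡ᵇ a in d≡ᵇa
    ... | true = ≤-trans (m≤m+n n (𝟙 (d ≡ᵇ b) * n)) (m≤n+m _ (stay W n d))
    ... | false with d ≡ᵇ b in d≡ᵇb
    ...   | true = ≤-trans (≤-reflexive (sym (+-identityʳ n))) (m≤n+m _ (stay W n d))
    ...   | false = begin
      n                     ≤⟨ m≤n+m∸n n d ⟩
      d + (n ∸ d)           ≡⟨ cong₂ _+_ (*-identityʳ d) (*-identityʳ (n ∸ d)) ⟨
      d * 1 + (n ∸ d) * 1
        ≡⟨ cong₂ (λ u v → d * 𝟙 u + (n ∸ d) * 𝟙 v) (cong₂ _∧_ d∈W pred∈W) (cong₂ _∧_ d∈W suc∈W) ⟨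
      stay W n d            ≡⟨ +-identityʳ (stay W n d) ⟨
      stay W n d + 0        ∎
      where
      open ≤-Reasoning
      a≤d : a ≤ d
      a≤d = proj₁ (inWindow⁻ d∈W)
      d≤b : d ≤ b
      d≤b = proj₂ (inWindow⁻ d∈W)
      pred∈W : W (pred d) ≡ true
      pred∈W = inWindow⁺ (<⇒≤pred (≤∧≢⇒< a≤d (≡ᵇ-false⇒≢ d≡ᵇa ∘ sym))) (≤-trans pred[n]≤n d≤b)
      suc∈W : W (suc d) ≡ true
      suc∈W = inWindow⁺ (m≤n⇒m≤1+n a≤d) (≤∧≢⇒< d≤b (≡ᵇ-false⇒≢ d≡ᵇb))

  window-boundary : ∀ n → a ≤ n → b ≤ n →
    n * vertices (inWindow a b) n ≤ innerEdges (inWindow a b) n + ((n C a) * n + (n C b) * n)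
  window-boundary n a≤n b≤n = begin
    n * sumUpTo (suc n) level                                     ≡⟨ sum-distribˡ-* L n level ⟨
    sumUpTo (suc n) (λ d → n * level d)                           ≤⟨ sum-mono L pointwise ⟩
    sumUpTo (suc n) (λ d → stays d + (at a d + at b d))           ≡⟨ sum-distrib-+ L stays (λ d → at a d + at b d) ⟩
    sumUpTo (suc n) stays + sumUpTo (suc n) (λ d → at a d + at b d)
      ≡⟨ cong (sumUpTo (suc n) stays +_) (sum-distrib-+ L (at a) (at b)) ⟩
    sumUpTo (suc n) stays + (sumUpTo (suc n) (at a) + sumUpTo (suc n) (at b))
      ≡⟨ cong (sumUpTo (suc n) stays +_) (cong₂ _+_ (sumUpTo-point (suc n) a (λ d → (n C d) * n) (s≤s a≤n))
                                                     (sumUpTo-point (suc n) b (λ d → (n C d) * n) (s≤s b≤n))) ⟩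
    sumUpTo (suc n) stays + ((n C a) * n + (n C b) * n)           ∎
    where
    open ≤-Reasoning
    W : ℕ → Bool
    W = inWindow a b
    L : IsLinearSum (sumUpTo (suc n))
    L = sumUpTo-isLinear (suc n)
    level stays : ℕ → ℕ
    level d = (n C d) * 𝟙 (W d)
    stays d = (n C d) * stay W n d
    at : ℕ → ℕ → ℕ
    at c d = 𝟙 (d ≡ᵇ c) * ((n C d) * n)
    expand : ∀ c s i j n → c * (s + (i + j) * n) ≡ c * s + (i * (c * n) + j * (c * n))
    expand = solve-∀
    pointwise : ∀ d → n * level d ≤ stays d + (at a d + at b d)
    pointwise d = begin
      n * ((n C d) * 𝟙 (W d))                                 ≡⟨ *-swap-inner n (n C d) _ ⟩
      (n C d) * (n * 𝟙 (W d))                                 ≤⟨ *-monoʳ-≤ (n C d) (stay-window n d) ⟩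
      (n C d) * (stay W n d + (𝟙 (d ≡ᵇ a) + 𝟙 (d ≡ᵇ b)) * n)
        ≡⟨ expand (n C d) (stay W n d) (𝟙 (d ≡ᵇ a)) (𝟙 (d ≡ᵇ b)) n ⟩
      stays d + (at a d + at b d)                             ∎

  central-vertices : ∀ {n w} → a + b ≡ n → a + w ≡ b → suc w * (n C a) ≤ vertices (inWindow a b) n
  central-vertices {n} {w} a+b≡n a+w≡b = begin
    suc w * (n C a)                        ≤⟨ sumUpTo-lower (suc w) (n C a) (λ t → level (a + t)) bound ⟩
    sumUpTo (suc w) (λ t → level (a + t))  ≤⟨ sumUpTo-≥-segment a (suc w) a level ⟩
    sumUpTo (a + (suc w + a)) level        ≡⟨ cong (λ N → sumUpTo N level) length ⟩
    sumUpTo (suc n) level                  ∎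
    where
    open ≤-Reasoning
    level : ℕ → ℕ
    level d = (n C d) * 𝟙 (inWindow a b d)
    length : a + (suc w + a) ≡ suc n
    length = trans (+-suc a (w + a)) (cong suc (trans (sym (+-assoc a w a))
               (trans (cong (_+ a) a+w≡b) (trans (+-comm b a) a+b≡n))))
    bound : ∀ t → t < suc w → n C a ≤ level (a + t)
    bound t (s≤s t≤w) = begin
      n C a                ≤⟨ nCj≤nCk (m≤m+n a t) (≤-trans (+-monoʳ-≤ a a+t≤b) (≤-reflexive a+b≡n)) ⟩
      n C (a + t)          ≡⟨ *-identityʳ _ ⟨
      (n C (a + t)) * 1    ≡⟨ cong (λ x → (n C (a + t)) * 𝟙 x) (inWindow⁺ (m≤m+n a t) a+t≤b) ⟨
      level (a + t)        ∎
      where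
      a+t≤b : a + t ≤ b
      a+t≤b = ≤-trans (+-monoʳ-≤ a t≤w) (≤-reflexive a+w≡b)

  -- The two boundary levels have equal size, and each is at most a (w + 1)-th of the whole window.
  central-window : ∀ {n w} → a + b ≡ n → a + w ≡ b →
    (suc w ∸ 2) * (n * vertices (inWindow a b) n) ≤ suc w * innerEdges (inWindow a b) n
  central-window {n} {w} a+b≡n a+w≡b = k*x≤k*g+2*x⇒[k∸2]*x≤k*g k (n * S) G (begin
    k * (n * S)                             ≤⟨ *-monoʳ-≤ k (window-boundary n a≤n b≤n) ⟩
    k * (G + ((n C a) * n + (n C b) * n))   ≡⟨ cong (λ c → k * (G + ((n C a) * n + c * n))) nCb≡nCa ⟩
    k * (G + ((n C a) * n + (n C a) * n))   ≡⟨ regroup k G (n C a) n ⟩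
    k * G + 2 * (n * (k * (n C a)))
      ≤⟨ +-monoʳ-≤ (k * G) (*-monoʳ-≤ 2 (*-monoʳ-≤ n (central-vertices a+b≡n a+w≡b))) ⟩
    k * G + 2 * (n * S)                     ∎)
    where
    open ≤-Reasoning
    k S G : ℕ
    k = suc w
    S = vertices (inWindow a b) n
    G = innerEdges (inWindow a b) n
    a≤n : a ≤ n
    a≤n = m+n≤o⇒m≤o a (≤-reflexive a+b≡n)
    b≤n : b ≤ n
    b≤n = m+n≤o⇒n≤o a (≤-reflexive a+b≡n)
    nCb≡nCa : n C b ≡ n C a
    nCb≡nCa = trans (nCk≡nC[n∸k] b≤n) (cong (n C_) (trans (cong (_∸ b) (sym a+b≡n)) (m+n∸n≡m a b)))
    regroup : ∀ k g c n → k * (g + (c * n + c * n)) ≡ k * g + 2 * (n * (k * c))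
    regroup = solve-∀

-- Product sets

𝟙-∧ : ∀ b c → 𝟙 (b ∧ c) ≡ 𝟙 b * 𝟙 c
𝟙-∧ true  c = sym (+-identityʳ (𝟙 c))
𝟙-∧ false c = refl

𝟙-allFin : ∀ n (p : Fin n → Bool) → 𝟙 (allFin n p) ≡ prodFin n (λ j → 𝟙 (p j))
𝟙-allFin zero    p = refl
𝟙-allFin (suc n) p = trans (𝟙-∧ (p zero) _) (cong (𝟙 (p zero) *_) (𝟙-allFin n (λ j → p (suc j))))

allFin-∧ : ∀ n (p q : Fin n → Bool) → (allFin n p ∧ allFin n q) ≡ allFin n (λ j → p j ∧ q j)
allFin-∧ zero    p q = refl
allFin-∧ (suc n) p q with p zero | q zero
... | true  | true  = allFin-∧ n _ _
... | true  | false = ∧-zeroʳ _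
... | false | _     = refl

0^n≡0 : ∀ {n} → 0 < n → 0 ^ n ≡ 0
0^n≡0 {suc n} _ = refl

module ProductSet (n : ℕ) (σ : F2^ n → Bool) (σ-cong : ∀ {x y} → (∀ i → x i ≡ y i) → σ x ≡ σ y) where

  S : ℕ
  S = sumF2^ n (λ x → 𝟙 (σ x))

  edgesAt : Fin n → ℕ
  edgesAt i = sumF2^ n (λ x → 𝟙 (σ x ∧ σ (flip i x)))

  E : ℕ
  E = sumFin n edgesAt

  inProduct : V n → Bool
  inProduct a = allFin n (λ j → σ (a j))

  sumV-inProduct : sumV n (λ a → 𝟙 (inProduct a)) ≡ S ^ n
  sumV-inProduct = begin
    sumV n (λ a → 𝟙 (inProduct a))                     ≡⟨ sum-cong (sumV-isLinear n) (λ a → 𝟙-allFin n _) ⟩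
    sumV n (λ a → prodFin n (λ j → 𝟙 (σ (a j))))       ≡⟨ sumΠ-prodFin (sumF2^-isLinear n) n (λ _ x → 𝟙 (σ x)) ⟩
    prodFin n (λ _ → S)                                ≡⟨ prodFin-const n S ⟩
    S ^ n                                              ∎
    where open ≡-Reasoning

  -- Adding e i j changes only the j-th block, where it flips coordinate i.
  block-count : ∀ (i j j′ : Fin n) →
                sumF2^ n (λ x → 𝟙 (σ x ∧ σ (λ i′ → x i′ xor (⌊ j′ ≟ᶠ j ⌋ ∧ ⌊ i′ ≟ᶠ i ⌋))))
                  ≡ (if ⌊ j′ ≟ᶠ j ⌋ then edgesAt i else S)
  block-count i j j′ with ⌊ j′ ≟ᶠ j ⌋
  ... | true  = refl
  ... | false = sum-cong (sumF2^-isLinear n)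
                  (λ x → cong 𝟙 (trans (cong (σ x ∧_) (σ-cong (λ i′ → xor-identityʳ (x i′)))) (∧-idem (σ x))))

  pairsAt : Fin n → Fin n → ℕ
  pairsAt i j = sumV n (λ a → 𝟙 (inProduct a ∧ inProduct (a ⊕ e i j)))

  S*pairsAt : ∀ (i j : Fin n) → S * pairsAt i j ≡ edgesAt i * S ^ n
  S*pairsAt i j = begin
    S * sumV n (λ a → 𝟙 (inProduct a ∧ inProduct (a ⊕ e i j)))
      ≡⟨ cong (S *_) (sum-cong (sumV-isLinear n) (λ a → trans (cong 𝟙 (allFin-∧ n _ _)) (𝟙-allFin n _))) ⟩
    S * sumV n (λ a → prodFin n (λ j′ → 𝟙 (σ (a j′) ∧ σ ((a ⊕ e i j) j′))))
      ≡⟨ cong (S *_) (sumΠ-prodFin (sumF2^-isLinear n) n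
                                   (λ j′ x → 𝟙 (σ x ∧ σ (λ i′ → x i′ xor e i j j′ i′)))) ⟩
    S * prodFin n (λ j′ → sumF2^ n (λ x → 𝟙 (σ x ∧ σ (λ i′ → x i′ xor e i j j′ i′))))
      ≡⟨ cong (S *_) (prodFin-cong n (block-count i j)) ⟩
    S * prodFin n (λ j′ → if ⌊ j′ ≟ᶠ j ⌋ then edgesAt i else S)
      ≡⟨ prodFin-single n j (edgesAt i) S ⟩
    edgesAt i * S ^ n ∎
    where open ≡-Reasoning

  pairs : ℕ
  pairs = sumV n (λ a → sumFin n (λ i → sumFin n (λ j → 𝟙 (inProduct a ∧ inProduct (a ⊕ e i j)))))

  S*pairs : S * pairs ≡ n * S ^ n * E
  S*pairs = begin
    S * pairs
      ≡⟨ cong (S *_) (sum-sumFin-comm Lᵥ n _) ⟩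
    S * sumFin n (λ i → sumV n (λ a → sumFin n (λ j → 𝟙 (inProduct a ∧ inProduct (a ⊕ e i j)))))
      ≡⟨ cong (S *_) (sum-cong Lᶠ (λ i → sum-sumFin-comm Lᵥ n _)) ⟩
    S * sumFin n (λ i → sumFin n (pairsAt i))
      ≡⟨ sum-distribˡ-* Lᶠ S _ ⟨
    sumFin n (λ i → S * sumFin n (pairsAt i))
      ≡⟨ sum-cong Lᶠ (λ i → sym (sum-distribˡ-* Lᶠ S (pairsAt i))) ⟩
    sumFin n (λ i → sumFin n (λ j → S * pairsAt i j))
      ≡⟨ sum-cong Lᶠ (λ i → trans (sum-cong Lᶠ (S*pairsAt i)) (sumFin-const n _)) ⟩
    sumFin n (λ i → n * (edgesAt i * S ^ n))
      ≡⟨ sum-cong Lᶠ (λ i → rearrange n (edgesAt i) (S ^ n)) ⟩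
    sumFin n (λ i → n * S ^ n * edgesAt i)
      ≡⟨ sum-distribˡ-* Lᶠ (n * S ^ n) edgesAt ⟩
    n * S ^ n * E ∎
    where
    open ≡-Reasoning
    Lᵥ : IsLinearSum (sumV n)
    Lᵥ = sumV-isLinear n
    Lᶠ : IsLinearSum (sumFin n)
    Lᶠ = sumFin-isLinear n
    rearrange : ∀ n g s → n * (g * s) ≡ n * s * g
    rearrange = solve-∀

  pairs-bound : ∀ c k → 0 < n → c * (n * S) ≤ k * E → c * sumV n (λ a → 𝟙 (inProduct a)) * (n * n) ≤ k * pairs
  pairs-bound c k 0<n cnS≤kE rewrite sumV-inProduct = cancel S cnS≤kE S*pairs
    where
    open ≤-Reasoning
    reorder₁ : ∀ s c t n → s * (c * t * (n * n)) ≡ c * (n * s) * (n * t)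
    reorder₁ = solve-∀
    reorder₂ : ∀ k e n t → k * e * (n * t) ≡ k * (n * t * e)
    reorder₂ = solve-∀
    cancel : ∀ s → c * (n * s) ≤ k * E → s * pairs ≡ n * s ^ n * E → c * s ^ n * (n * n) ≤ k * pairs
    cancel zero _ _ =
      ≤-trans (≤-reflexive (trans (cong (λ t → c * t * (n * n)) (0^n≡0 0<n)) (cong (_* (n * n)) (*-zeroʳ c)))) z≤n
    cancel s@(suc _) cns≤kE s*pairs≡ = *-cancelˡ-≤ s (begin
      s * (c * s ^ n * (n * n))  ≡⟨ reorder₁ s c (s ^ n) n ⟩
      c * (n * s) * (n * s ^ n)  ≤⟨ *-monoˡ-≤ (n * s ^ n) cns≤kE ⟩
      k * E * (n * s ^ n)        ≡⟨ reorder₂ k E n (s ^ n) ⟩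
      k * (n * s ^ n * E)        ≡⟨ cong (k *_) s*pairs≡ ⟨
      k * (s * pairs)            ≡⟨ *-swap-inner k s pairs ⟩
      s * (k * pairs)            ∎)

central-window-sides : ∀ {a k m} → a + k ≡ m → a + (m + k) ≡ 2 * m × a + 2 * k ≡ m + k
central-window-sides {a} {k} refl = sides a k , halves a k
  where
  sides : ∀ a k → a + ((a + k) + k) ≡ 2 * (a + k)
  sides = solve-∀
  halves : ∀ a k → a + 2 * k ≡ (a + k) + k
  halves = solve-∀

k′≤m′ : ∀ k′ m′ → 10 * (2 * k′ + 1) ^ 2 < 2 * m′ → k′ ≤ m′
k′≤m′ k′ m′ 10k²<2m′ =
  *-cancelˡ-≤ 2 (<⇒≤ (≤-<-trans (m≤m+n (2 * k′) _) (subst (_< 2 * m′) (expand k′) 10k²<2m′)))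
  where
  expand : ∀ k → 10 * ((2 * k + 1) * ((2 * k + 1) * 1)) ≡ 2 * k + (40 * k * k + 38 * k + 10)
  expand = solve-∀

lemma3p1 : (k' m' : ℕ) → 0 < 2 * m' → 10 * (2 * k' + 1) ^ 2 < 2 * m' →
    ((2 * k' + 1) ∸ 2) * cardA m' k' * ((2 * m') * (2 * m')) ≤ (2 * k' + 1) * goodPairs m' k'
lemma3p1 k' m' 0<n 10k²<n = pairs-bound (k ∸ 2) k 0<n block
  where
  n k : ℕ
  n = 2 * m'
  k = 2 * k' + 1
  W : ℕ → Bool
  W = inWindow (m' ∸ k') (m' + k')
  open ProductSet n (inΣ m' k') (λ x≗y → cong W (weight-cong x≗y))
  sides : (m' ∸ k') + (m' + k') ≡ n × (m' ∸ k') + 2 * k' ≡ m' + k'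
  sides = central-window-sides {m' ∸ k'} {k'} (m∸n+n≡m (k′≤m′ k' m' 10k²<n))
  window-block : (k ∸ 2) * (n * vertices W n) ≤ k * innerEdges W n
  window-block = subst (λ c → (c ∸ 2) * (n * vertices W n) ≤ c * innerEdges W n) (+-comm 1 (2 * k'))
                       (central-window {m' ∸ k'} {m' + k'} (proj₁ sides) (proj₂ sides))
  block : (k ∸ 2) * (n * S) ≤ k * E
  block = subst₂ (λ s g → (k ∸ 2) * (n * s) ≤ k * g) (sym (sumF2^-vertices n W)) (sym (sumFin-sumF2^-flip n W))
                 window-block
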